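{- Let $X$ be an orientable map with transition matrix $U$. Then $U=I$ if and only if $X$ is a quasi-tree bouquet, i.e. $X$ has exactly one vertex and exactly one face.
   Context: An orientable map $X$ is a 2-cell embedding of a finite connected multigraph (loops and parallel edges allowed) in a closed orientable surface, with vertex set $V$ and face set $F$. Each edge gives two arcs on opposite sides of it, pointing in opposite directions, each lying in a face and oriented along its clockwise facial walk. Let $\mathcal A$ be the arc set, $v(a)$ the tail vertex and $f(a)$ the face of arc $a$; $N\in\{0,1\}^{\mathcal A\times V}$ with $N(a,w)=1$ iff $w=v(a)$; $M\in\{0,1\}^{\mathcal A\times F}$ with $M(a,f)=1$ iff $f=f(a)$; $D=N^TN$, $\Delta=M^TM$; $\hat N=ND^{ -1/2}$, $\hat M=M\Delta^{ -1/2}$, $Q=\hat N\hat N^T$, $P=\hat M\hat M^T$; $U=(2P-I)(2Q-I)$. -}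

module Defs where

open import Data.Nat using (ℕ; zero; suc; _≤_)
open import Data.Fin using (Fin; zero; suc)
import Data.Fin as Fin
open import Data.Fin.Permutation using (Permutation′; _⟨$⟩ʳ_)
open import Data.Rational using (ℚ; 0ℚ; 1ℚ; _+_; _*_; _-_; 1/_; ≢-nonZero)
open import Data.Rational.Properties using (_≟_)
open import Data.Product using (∃; _×_; _,_)
open import Relation.Binary.PropositionalEquality using (_≡_; _≢_)
open import Relation.Nullary using (¬_; yes; no)

Matrix : ℕ → ℕ → Set
Matrix m n = Fin m → Fin n → ℚ

sumᶠ : ∀ {n} → (Fin n → ℚ) → ℚ
sumᶠ {zero}  f = 0ℚ
sumᶠ {suc n} f = f zero + sumᶠ (λ i → f (suc i))

infixl 7 _·_
_·_ : ∀ {m n k} → Matrix m n → Matrix n k → Matrix m k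
(A · B) i j = sumᶠ (λ l → A i l * B l j)

_ᵀ : ∀ {m n} → Matrix m n → Matrix n m
(A ᵀ) i j = A j i

𝕀 : ∀ {n} → Matrix n n
𝕀 i j with i Fin.≟ j
... | yes _ = 1ℚ
... | no  _ = 0ℚ

twiceMinusI : ∀ {n} → Matrix n n → Matrix n n
twiceMinusI A i j = (A i j + A i j) - 𝕀 i j

diag : ∀ {n} → (Fin n → ℚ) → Matrix n n
diag d i j with i Fin.≟ j
... | yes _ = d i
... | no  _ = 0ℚ

-- total inverse on ℚ (only ever applied to nonzero diagonal entries)
inv : ℚ → ℚ
inv p with p ≟ 0ℚ
... | yes _   = 0ℚ
... | no  p≢0 = 1/_ p {{≢-nonZero p≢0}}

incidence : ∀ {m n} → (Fin m → Fin n) → Matrix m n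
incidence g a w with g a Fin.≟ w
... | yes _ = 1ℚ
... | no  _ = 0ℚ

-- For an incidence matrix X with diagonal Gram matrix G = XᵀX,
-- X̂ X̂ᵀ = X G^{-1/2} G^{-1/2} Xᵀ = X G^{-1} Xᵀ.
normalizedProjection : ∀ {m n} → Matrix m n → Matrix m m
normalizedProjection X = X · diag (λ w → inv (((X ᵀ) · X) w w)) · (X ᵀ)

_^[_] : {A : Set} → (A → A) → ℕ → A → A
(f ^[ zero ])  x = x
(f ^[ suc k ]) x = f ((f ^[ k ]) x)

SameOrbit : {A : Set} → (A → A) → A → A → Set
SameOrbit f a b = ∃ λ k → (f ^[ k ]) a ≡ b

data Reach {n : ℕ} (σ α : Fin n → Fin n) (a : Fin n) : Fin n → Set where
  here  : Reach σ α a a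
  stepσ : ∀ {b} → Reach σ α a b → Reach σ α a (σ b)
  stepα : ∀ {b} → Reach σ α a b → Reach σ α a (α b)

record OrientableMap : Set where
  field
    nA nV nF : ℕ                      -- numbers of arcs, vertices, faces
    σ      : Permutation′ nA          -- rotation of arcs around their tail vertex
    α      : Fin nA → Fin nA          -- the other arc of the same edge
    α-invol : ∀ a → α (α a) ≡ a
    α-fpf   : ∀ a → α a ≢ a
    tail   : Fin nA → Fin nV
    face   : Fin nA → Fin nF
    tail-surj : ∀ w → ∃ λ a → tail a ≡ w
    face-surj : ∀ f → ∃ λ a → face a ≡ f
    tail-orbit : ∀ a b → (tail a ≡ tail b → SameOrbit (σ ⟨$⟩ʳ_) a b)
                       × (SameOrbit (σ ⟨$⟩ʳ_) a b → tail a ≡ tail b)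
    -- facial successor φ = σ ∘ α : next arc along the clockwise facial walk
    face-orbit : ∀ a b → (face a ≡ face b → SameOrbit (λ x → σ ⟨$⟩ʳ (α x)) a b)
                       × (SameOrbit (λ x → σ ⟨$⟩ʳ (α x)) a b → face a ≡ face b)
    connected : ∀ a b → Reach (σ ⟨$⟩ʳ_) α a b
    nonempty  : 1 ≤ nA

open OrientableMap public

N : (X : OrientableMap) → Matrix (nA X) (nV X)
N X = incidence (tail X)

M : (X : OrientableMap) → Matrix (nA X) (nF X)
M X = incidence (face X)

Q : (X : OrientableMap) → Matrix (nA X) (nA X)
Q X = normalizedProjection (N X)

P : (X : OrientableMap) → Matrix (nA X) (nA X)
P X = normalizedProjection (M X)

U : (X : OrientableMap) → Matrix (nA X) (nA X)
U X = twiceMinusI (P X) · twiceMinusI (Q X)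

-- P and Q are the orthogonal projections onto the vectors constant on faces and on
-- vertices, so U = (2P - I)(2Q - I) = I + 2(2PQ - P - Q), and U = I says 2PQ = P + Q.
-- On the diagonal entry of an arc a, with x and y the indicator vectors of the face and
-- of the tail of a, this reads 2⟨x, y⟩ = |x|² + |y|² once the denominators |x|², |y|²
-- are cleared, i.e. |x - y|² = 0: the face of a and the vertex of a contain the same arcs. As σ fixes tails and σα fixes faces, α
-- then fixes tails, and connectivity leaves a single vertex and hence a single face.
-- Conversely, with one vertex and one face P = Q = J/|A| is idempotent, so 2PQ = P + Q.
module Submission where

open import Defs
open import Data.Empty using (⊥-elim)
open import Data.Fin using (Fin; zero; suc)
import Data.Fin as Fin
open import Data.Fin.Permutation using (_⟨$⟩ʳ_)
open import Data.Fin.Properties using (suc-injective)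
open import Data.Nat using (ℕ; zero; suc)
open import Data.Product using (_×_; _,_; proj₁; proj₂; ∃)
open import Data.Rational using (ℚ; 0ℚ; 1ℚ; ½; _+_; _*_; _-_; _≤_; _<_; ≢-nonZero; positive; negative)
open import Data.Rational.Properties
open import Algebra.Properties.Group +-0-group using (x∙y⁻¹≈ε⇒x≈y; x≈y⇒x∙y⁻¹≈ε; identityʳ-unique)
open import Data.Rational.Solver using (module +-*-Solver)
open import Function.Base using (_∘_)
open import Function.Bundles using (_⇔_; mk⇔; Equivalence)
open import Relation.Binary.Definitions using (tri<; tri≈; tri>)
open import Relation.Binary.PropositionalEquality
open import Relation.Nullary using (yes; no)
open import Relation.Nullary.Decidable using (decidable-stable)

open +-*-Solver using (solve; _:+_; _:*_; _:-_; _:=_; con)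
open ≡-Reasoning

0<p*p : ∀ p → p ≢ 0ℚ → 0ℚ < p * p
0<p*p p p≢0 with <-cmp p 0ℚ
... | tri< p<0 _ _ = positive⁻¹ (p * p) {{neg*neg⇒pos p {{negative p<0}} p {{negative p<0}}}}
... | tri≈ _ p≡0 _ = ⊥-elim (p≢0 p≡0)
... | tri> _ _ p>0 = positive⁻¹ (p * p) {{pos*pos⇒pos p {{positive p>0}} p {{positive p>0}}}}

0≤p*p : ∀ p → 0ℚ ≤ p * p
0≤p*p p with p ≟ 0ℚ
... | yes refl = ≤-refl
... | no p≢0   = <⇒≤ (0<p*p p p≢0)

p*p≡0⇒p≡0 : ∀ p → p * p ≡ 0ℚ → p ≡ 0ℚ
p*p≡0⇒p≡0 p p*p≡0 with p ≟ 0ℚ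
... | yes p≡0 = p≡0
... | no p≢0  = ⊥-elim (<⇒≢ (0<p*p p p≢0) (sym p*p≡0))

p+p≡0⇒p≡0 : ∀ p → p + p ≡ 0ℚ → p ≡ 0ℚ
p+p≡0⇒p≡0 p p+p≡0 = begin
  p            ≡⟨ solve 1 (λ p → p := con ½ :* (p :+ p)) refl p ⟩
  ½ * (p + p)  ≡⟨ cong (½ *_) p+p≡0 ⟩
  ½ * 0ℚ       ≡⟨ *-zeroʳ ½ ⟩
  0ℚ           ∎

nonNeg+nonNeg≡0⇒≡0 : ∀ {p q} → 0ℚ ≤ p → 0ℚ ≤ q → p + q ≡ 0ℚ → p ≡ 0ℚ × q ≡ 0ℚ
nonNeg+nonNeg≡0⇒≡0 {p} {q} 0≤p 0≤q p+q≡0 = p≡0 , q≡0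
  where
  p≡0 : p ≡ 0ℚ
  p≡0 = ≤-antisym (≤-trans (≤-reflexive (sym (+-identityʳ p)))
                           (≤-trans (+-monoʳ-≤ p 0≤q) (≤-reflexive p+q≡0))) 0≤p
  q≡0 : q ≡ 0ℚ
  q≡0 = trans (sym (+-identityˡ q)) (subst (λ r → r + q ≡ 0ℚ) p≡0 p+q≡0)

inv-inverseˡ : ∀ p → p ≢ 0ℚ → inv p * p ≡ 1ℚ
inv-inverseˡ p p≢0 with p ≟ 0ℚ
... | yes p≡0 = ⊥-elim (p≢0 p≡0)
... | no p≢0  = *-inverseˡ p {{≢-nonZero p≢0}}

cross-multiply : ∀ {F V iF iV} k → iF * F ≡ 1ℚ → iV * V ≡ 1ℚ →
  iF * iV * k + iF * iV * k ≡ iF + iV → k + k ≡ F + V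
cross-multiply {F} {V} {iF} {iV} k iF*F≡1 iV*V≡1 balance = begin
  k + k                                ≡⟨ solve 1 (λ k → k :+ k := (k :+ k) :* (con 1ℚ :* con 1ℚ)) refl k ⟩
  (k + k) * (1ℚ * 1ℚ)                  ≡⟨ cong₂ (λ u v → (k + k) * (u * v)) (sym iF*F≡1) (sym iV*V≡1) ⟩
  (k + k) * ((iF * F) * (iV * V))      ≡⟨ solve 5 (λ F V iF iV k → (k :+ k) :* ((iF :* F) :* (iV :* V))
                                                     := F :* V :* (iF :* iV :* k :+ iF :* iV :* k)) refl F V iF iV k ⟩
  F * V * (iF * iV * k + iF * iV * k)  ≡⟨ cong (F * V *_) balance ⟩
  F * V * (iF + iV)                    ≡⟨ solve 4 (λ F V iF iV → F :* V :* (iF :+ iV)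
                                                     := (iF :* F) :* V :+ (iV :* V) :* F) refl F V iF iV ⟩
  (iF * F) * V + (iV * V) * F          ≡⟨ cong₂ (λ u v → u * V + v * F) iF*F≡1 iV*V≡1 ⟩
  1ℚ * V + 1ℚ * F                      ≡⟨ solve 2 (λ F V → con 1ℚ :* V :+ con 1ℚ :* F := F :+ V) refl F V ⟩
  F + V                                ∎

sumᶠ-cong : ∀ {n} {f g : Fin n → ℚ} → (∀ i → f i ≡ g i) → sumᶠ f ≡ sumᶠ g
sumᶠ-cong {zero}  f≗g = refl
sumᶠ-cong {suc n} f≗g = cong₂ _+_ (f≗g zero) (sumᶠ-cong (f≗g ∘ suc))

sumᶠ-zero : ∀ n → sumᶠ {n} (λ _ → 0ℚ) ≡ 0ℚ
sumᶠ-zero zero    = refl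
sumᶠ-zero (suc n) = trans (+-identityˡ _) (sumᶠ-zero n)

sumᶠ-+ : ∀ {n} (f g : Fin n → ℚ) → sumᶠ (λ i → f i + g i) ≡ sumᶠ f + sumᶠ g
sumᶠ-+ {zero}  f g = refl
sumᶠ-+ {suc n} f g =
  trans (cong (f zero + g zero +_) (sumᶠ-+ (f ∘ suc) (g ∘ suc))) (middle-swap (f zero) (g zero) _ _)
  where
  middle-swap : ∀ a b c d → (a + b) + (c + d) ≡ (a + c) + (b + d)
  middle-swap = solve 4 (λ a b c d → (a :+ b) :+ (c :+ d) := (a :+ c) :+ (b :+ d)) refl

sumᶠ-- : ∀ {n} (f g : Fin n → ℚ) → sumᶠ (λ i → f i - g i) ≡ sumᶠ f - sumᶠ g
sumᶠ-- {zero}  f g = refl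
sumᶠ-- {suc n} f g =
  trans (cong (f zero - g zero +_) (sumᶠ-- (f ∘ suc) (g ∘ suc))) (middle-swap (f zero) (g zero) _ _)
  where
  middle-swap : ∀ a b c d → (a - b) + (c - d) ≡ (a + c) - (b + d)
  middle-swap = solve 4 (λ a b c d → (a :- b) :+ (c :- d) := (a :+ c) :- (b :+ d)) refl

sumᶠ-*ˡ : ∀ {n} k (f : Fin n → ℚ) → sumᶠ (λ i → k * f i) ≡ k * sumᶠ f
sumᶠ-*ˡ {zero}  k f = sym (*-zeroʳ k)
sumᶠ-*ˡ {suc n} k f = trans (cong (k * f zero +_) (sumᶠ-*ˡ k (f ∘ suc))) (sym (*-distribˡ-+ k _ _))

sumᶠ-single : ∀ {n} (i : Fin n) (f : Fin n → ℚ) → (∀ j → j ≢ i → f j ≡ 0ℚ) → sumᶠ f ≡ f i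
sumᶠ-single {suc n} zero f vanish = begin
  f zero + sumᶠ (f ∘ suc)       ≡⟨ cong (f zero +_) (sumᶠ-cong (λ j → vanish (suc j) λ ())) ⟩
  f zero + sumᶠ {n} (λ _ → 0ℚ)  ≡⟨ cong (f zero +_) (sumᶠ-zero n) ⟩
  f zero + 0ℚ                   ≡⟨ +-identityʳ (f zero) ⟩
  f zero                        ∎
sumᶠ-single {suc n} (suc i) f vanish = begin
  f zero + sumᶠ (f ∘ suc)       ≡⟨ cong (_+ sumᶠ (f ∘ suc)) (vanish zero λ ()) ⟩
  0ℚ + sumᶠ (f ∘ suc)           ≡⟨ +-identityˡ _ ⟩
  sumᶠ (f ∘ suc)                ≡⟨ sumᶠ-single i (f ∘ suc) (λ j j≢i → vanish (suc j) (j≢i ∘ suc-injective)) ⟩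
  f (suc i)                     ∎

sumᶠ-nonNeg : ∀ {n} (f : Fin n → ℚ) → (∀ i → 0ℚ ≤ f i) → 0ℚ ≤ sumᶠ f
sumᶠ-nonNeg {zero}  f 0≤f = ≤-refl
sumᶠ-nonNeg {suc n} f 0≤f = +-mono-≤ (0≤f zero) (sumᶠ-nonNeg (f ∘ suc) (0≤f ∘ suc))

sumᶠ-nonNeg-≡0 : ∀ {n} (f : Fin n → ℚ) → (∀ i → 0ℚ ≤ f i) → sumᶠ f ≡ 0ℚ → ∀ i → f i ≡ 0ℚ
sumᶠ-nonNeg-≡0 f 0≤f ∑f≡0 zero =
  proj₁ (nonNeg+nonNeg≡0⇒≡0 (0≤f zero) (sumᶠ-nonNeg (f ∘ suc) (0≤f ∘ suc)) ∑f≡0)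
sumᶠ-nonNeg-≡0 f 0≤f ∑f≡0 (suc i) = sumᶠ-nonNeg-≡0 (f ∘ suc) (0≤f ∘ suc)
  (proj₂ (nonNeg+nonNeg≡0⇒≡0 (0≤f zero) (sumᶠ-nonNeg (f ∘ suc) (0≤f ∘ suc)) ∑f≡0)) i

sumᶠ-square-of-difference : ∀ {n} (x y : Fin n → ℚ) →
  let k = sumᶠ (λ c → x c * y c) in
  sumᶠ (λ c → (x c - y c) * (x c - y c)) ≡ (sumᶠ (λ c → x c * x c) + sumᶠ (λ c → y c * y c)) - (k + k)
sumᶠ-square-of-difference x y = begin
  sumᶠ (λ c → (x c - y c) * (x c - y c))
    ≡⟨ sumᶠ-cong (λ c → square-of-difference (x c) (y c)) ⟩
  sumᶠ (λ c → (x c * x c + y c * y c) - (xy c + xy c))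
    ≡⟨ sumᶠ-- (λ c → x c * x c + y c * y c) (λ c → xy c + xy c) ⟩
  sumᶠ (λ c → x c * x c + y c * y c) - sumᶠ (λ c → xy c + xy c)
    ≡⟨ cong₂ _-_ (sumᶠ-+ (λ c → x c * x c) (λ c → y c * y c)) (sumᶠ-+ xy xy) ⟩
  (sumᶠ (λ c → x c * x c) + sumᶠ (λ c → y c * y c)) - (sumᶠ xy + sumᶠ xy) ∎
  where
  xy : _ → ℚ
  xy c = x c * y c
  square-of-difference : ∀ a b → (a - b) * (a - b) ≡ (a * a + b * b) - (a * b + a * b)
  square-of-difference = solve 2 (λ a b → (a :- b) :* (a :- b) := (a :* a :+ b :* b) :- (a :* b :+ a :* b)) refl

count : ℕ → ℚ
count n = sumᶠ {n} (λ _ → 1ℚ)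

𝕀-refl : ∀ {n} (i : Fin n) → 𝕀 i i ≡ 1ℚ
𝕀-refl i with i Fin.≟ i
... | yes _  = refl
... | no i≢i = ⊥-elim (i≢i refl)

𝕀-≢ : ∀ {n} {i j : Fin n} → i ≢ j → 𝕀 i j ≡ 0ℚ
𝕀-≢ {i = i} {j} i≢j with i Fin.≟ j
... | yes i≡j = ⊥-elim (i≢j i≡j)
... | no _    = refl

diag-refl : ∀ {n} (d : Fin n → ℚ) i → diag d i i ≡ d i
diag-refl d i with i Fin.≟ i
... | yes _  = refl
... | no i≢i = ⊥-elim (i≢i refl)

diag-≢ : ∀ {n} (d : Fin n → ℚ) {i j} → i ≢ j → diag d i j ≡ 0ℚ
diag-≢ d {i} {j} i≢j with i Fin.≟ j
... | yes i≡j = ⊥-elim (i≢j i≡j)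
... | no _    = refl

·-identityˡ : ∀ {m n} (A : Matrix m n) i j → (𝕀 · A) i j ≡ A i j
·-identityˡ A i j = begin
  sumᶠ (λ c → 𝕀 i c * A c j)  ≡⟨ sumᶠ-single i _ vanish ⟩
  𝕀 i i * A i j               ≡⟨ cong (_* A i j) (𝕀-refl i) ⟩
  1ℚ * A i j                  ≡⟨ *-identityˡ (A i j) ⟩
  A i j                       ∎
  where
  vanish : ∀ c → c ≢ i → 𝕀 i c * A c j ≡ 0ℚ
  vanish c c≢i = trans (cong (_* A c j) (𝕀-≢ (c≢i ∘ sym))) (*-zeroˡ (A c j))

·-identityʳ : ∀ {m n} (A : Matrix m n) i j → (A · 𝕀) i j ≡ A i j
·-identityʳ A i j = begin
  sumᶠ (λ c → A i c * 𝕀 c j)  ≡⟨ sumᶠ-single j _ vanish ⟩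
  A i j * 𝕀 j j               ≡⟨ cong (A i j *_) (𝕀-refl j) ⟩
  A i j * 1ℚ                  ≡⟨ *-identityʳ (A i j) ⟩
  A i j                       ∎
  where
  vanish : ∀ c → c ≢ j → A i c * 𝕀 c j ≡ 0ℚ
  vanish c c≢j = trans (cong (A i c *_) (𝕀-≢ c≢j)) (*-zeroʳ (A i c))

·-diag : ∀ {m n} (A : Matrix m n) (d : Fin n → ℚ) i j → (A · diag d) i j ≡ A i j * d j
·-diag A d i j = trans (sumᶠ-single j _ vanish) (cong (A i j *_) (diag-refl d j))
  where
  vanish : ∀ c → c ≢ j → A i c * diag d c j ≡ 0ℚ
  vanish c c≢j = trans (cong (A i c *_) (diag-≢ d c≢j)) (*-zeroʳ (A i c))

·-uniform : ∀ {n} {A B : Matrix n n} {p} → (∀ i j → A i j ≡ p) → (∀ i j → B i j ≡ p) →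
  p * count n ≡ 1ℚ → ∀ i j → (A · B) i j ≡ p
·-uniform {n} {A} {B} {p} A≡p B≡p p*n≡1 i j = begin
  sumᶠ (λ c → A i c * B c j)     ≡⟨ sumᶠ-cong (λ c → trans (cong₂ _*_ (A≡p i c) (B≡p c j))
                                                            (sym (*-identityʳ (p * p)))) ⟩
  sumᶠ {n} (λ _ → (p * p) * 1ℚ)  ≡⟨ sumᶠ-*ˡ {n} (p * p) (λ _ → 1ℚ) ⟩
  (p * p) * count n              ≡⟨ *-assoc p p (count n) ⟩
  p * (p * count n)              ≡⟨ cong (p *_) p*n≡1 ⟩
  p * 1ℚ                         ≡⟨ *-identityʳ p ⟩
  p                              ∎

twiceMinusI-·-expand : ∀ {n} (A B : Matrix n n) i j →
  let e = ((A · B) i j + (A · B) i j) - (A i j + B i j) in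
  (twiceMinusI A · twiceMinusI B) i j ≡ 𝕀 i j + (e + e)
twiceMinusI-·-expand A B i j = begin
  sumᶠ (λ c → twiceMinusI A i c * twiceMinusI B c j) ≡⟨ sumᶠ-cong (λ c → expand (A i c) (𝕀 i c) (B c j) (𝕀 c j)) ⟩
  sumᶠ (λ c → 𝕀 i c * 𝕀 c j + (r c + r c))           ≡⟨ sumᶠ-+ (λ c → 𝕀 i c * 𝕀 c j) (λ c → r c + r c) ⟩
  (𝕀 · 𝕀) i j + sumᶠ (λ c → r c + r c)               ≡⟨ cong₂ _+_ (·-identityˡ 𝕀 i j) (sumᶠ-+ r r) ⟩
  𝕀 i j + (sumᶠ r + sumᶠ r)                          ≡⟨ cong (λ s → 𝕀 i j + (s + s)) ∑r ⟩
  𝕀 i j + (e + e)                                    ∎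
  where
  AB e : ℚ
  AB = (A · B) i j
  e = (AB + AB) - (A i j + B i j)
  AI IB : _ → ℚ
  AI c = A i c * 𝕀 c j
  IB c = 𝕀 i c * B c j
  r : _ → ℚ
  r c = (A i c * B c j + A i c * B c j) - (AI c + IB c)
  expand : ∀ a d b f → let s = a * b + a * b - (a * f + d * b) in
           ((a + a) - d) * ((b + b) - f) ≡ d * f + (s + s)
  expand = solve 4 (λ a d b f → let s = a :* b :+ a :* b :- (a :* f :+ d :* b) in
                                ((a :+ a) :- d) :* ((b :+ b) :- f) := d :* f :+ (s :+ s)) refl
  ∑r : sumᶠ r ≡ e
  ∑r = begin
    sumᶠ r                                                        ≡⟨ sumᶠ-- _ (λ c → AI c + IB c) ⟩
    sumᶠ (λ c → A i c * B c j + A i c * B c j) - sumᶠ (λ c → AI c + IB c)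
      ≡⟨ cong₂ _-_ (sumᶠ-+ (λ c → A i c * B c j) (λ c → A i c * B c j)) (sumᶠ-+ AI IB) ⟩
    (AB + AB) - ((A · 𝕀) i j + (𝕀 · B) i j)
      ≡⟨ cong (λ s → (AB + AB) - s) (cong₂ _+_ (·-identityʳ A i j) (·-identityˡ B i j)) ⟩
    e                                                             ∎

twiceMinusI-·-≡𝕀 : ∀ {n} (A B : Matrix n n) i j →
  (twiceMinusI A · twiceMinusI B) i j ≡ 𝕀 i j ⇔ (A · B) i j + (A · B) i j ≡ A i j + B i j
twiceMinusI-·-≡𝕀 A B i j = mk⇔
  (λ U≡𝕀 → x∙y⁻¹≈ε⇒x≈y _ _ (p+p≡0⇒p≡0 e (identityʳ-unique (𝕀 i j) (e + e)
                                           (trans (sym (twiceMinusI-·-expand A B i j)) U≡𝕀))))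
  (λ 2AB≡A+B → begin
    (twiceMinusI A · twiceMinusI B) i j ≡⟨ twiceMinusI-·-expand A B i j ⟩
    𝕀 i j + (e + e)                     ≡⟨ cong (λ e → 𝕀 i j + (e + e)) (x≈y⇒x∙y⁻¹≈ε 2AB≡A+B) ⟩
    𝕀 i j + (0ℚ + 0ℚ)                   ≡⟨ +-identityʳ (𝕀 i j) ⟩
    𝕀 i j                               ∎)
  where
  e : ℚ
  e = ((A · B) i j + (A · B) i j) - (A i j + B i j)

incidence-≡ : ∀ {m n} (g : Fin m → Fin n) {a w} → g a ≡ w → incidence g a w ≡ 1ℚ
incidence-≡ g {a} {w} ga≡w with g a Fin.≟ w
... | yes _   = refl
... | no ga≢w = ⊥-elim (ga≢w ga≡w)

incidence-≢ : ∀ {m n} (g : Fin m → Fin n) {a w} → g a ≢ w → incidence g a w ≡ 0ℚ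
incidence-≢ g {a} {w} ga≢w with g a Fin.≟ w
... | yes ga≡w = ⊥-elim (ga≢w ga≡w)
... | no _     = refl

incidence-≡⇒ : ∀ {m n k l} (g : Fin m → Fin n) (h : Fin k → Fin l) {a w b v} →
  incidence g a w ≡ incidence h b v → g a ≡ w → h b ≡ v
incidence-≡⇒ g h {b = b} {v} same ga≡w = decidable-stable (h b Fin.≟ v) (λ hb≢v →
  1≢0 (trans (sym (incidence-≡ g ga≡w)) (trans same (incidence-≢ h hb≢v))))

degree : ∀ {m n} → (Fin m → Fin n) → Fin n → ℚ
degree g w = ((incidence g ᵀ) · incidence g) w w

degree-≢0 : ∀ {m n} (g : Fin m → Fin n) a → degree g (g a) ≢ 0ℚ
degree-≢0 g a deg≡0 = 1≢0 (begin
  1ℚ                                         ≡⟨ sym (*-identityˡ 1ℚ) ⟩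
  1ℚ * 1ℚ                                    ≡⟨ cong₂ _*_ (sym ga∈fibre) (sym ga∈fibre) ⟩
  incidence g a (g a) * incidence g a (g a)  ≡⟨ sumᶠ-nonNeg-≡0 _ (λ c → 0≤p*p (incidence g c (g a))) deg≡0 a ⟩
  0ℚ                                         ∎)
  where
  ga∈fibre : incidence g a (g a) ≡ 1ℚ
  ga∈fibre = incidence-≡ g refl

constant⇒degree≡count : ∀ {m n} (g : Fin m → Fin n) → (∀ c d → g c ≡ g d) →
  ∀ a → degree g (g a) ≡ count m
constant⇒degree≡count g constant a = sumᶠ-cong (λ c →
  trans (cong₂ _*_ (incidence-≡ g (constant c a)) (incidence-≡ g (constant c a))) (*-identityˡ 1ℚ))

normalizedProjection-entry : ∀ {m n} (X : Matrix m n) i j →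
  normalizedProjection X i j ≡ sumᶠ (λ l → (X i l * inv (((X ᵀ) · X) l l)) * X j l)
normalizedProjection-entry X i j =
  sumᶠ-cong (λ l → cong (_* X j l) (·-diag X (λ w → inv (((X ᵀ) · X) w w)) i l))

normalizedProjection-sym : ∀ {m n} (X : Matrix m n) i j → normalizedProjection X i j ≡ normalizedProjection X j i
normalizedProjection-sym X i j = begin
  normalizedProjection X i j          ≡⟨ normalizedProjection-entry X i j ⟩
  sumᶠ (λ l → (X i l * d l) * X j l)  ≡⟨ sumᶠ-cong (λ l → swap (X i l) (d l) (X j l)) ⟩
  sumᶠ (λ l → (X j l * d l) * X i l)  ≡⟨ sym (normalizedProjection-entry X j i) ⟩
  normalizedProjection X j i          ∎
  where
  d : _ → ℚ
  d l = inv (((X ᵀ) · X) l l)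
  swap : ∀ x e y → (x * e) * y ≡ (y * e) * x
  swap = solve 3 (λ x e y → (x :* e) :* y := (y :* e) :* x) refl

projection-incidence : ∀ {m n} (g : Fin m → Fin n) a c →
  normalizedProjection (incidence g) a c ≡ inv (degree g (g a)) * incidence g c (g a)
projection-incidence g a c = begin
  normalizedProjection X a c         ≡⟨ normalizedProjection-entry X a c ⟩
  sumᶠ (λ l → (X a l * d l) * X c l) ≡⟨ sumᶠ-single (g a) _ off-fibre ⟩
  (X a (g a) * d (g a)) * X c (g a)  ≡⟨ cong (λ x → (x * d (g a)) * X c (g a)) (incidence-≡ g refl) ⟩
  (1ℚ * d (g a)) * X c (g a)         ≡⟨ cong (_* X c (g a)) (*-identityˡ (d (g a))) ⟩
  d (g a) * X c (g a)                ∎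
  where
  X : Matrix _ _
  X = incidence g
  d : _ → ℚ
  d w = inv (degree g w)
  off-fibre : ∀ l → l ≢ g a → (X a l * d l) * X c l ≡ 0ℚ
  off-fibre l l≢ga = begin
    (X a l * d l) * X c l  ≡⟨ cong (λ x → (x * d l) * X c l) (incidence-≢ g (l≢ga ∘ sym)) ⟩
    (0ℚ * d l) * X c l     ≡⟨ cong (_* X c l) (*-zeroˡ (d l)) ⟩
    0ℚ * X c l             ≡⟨ *-zeroˡ (X c l) ⟩
    0ℚ                     ∎

projection-incidence-diag : ∀ {m n} (g : Fin m → Fin n) a →
  normalizedProjection (incidence g) a a ≡ inv (degree g (g a))
projection-incidence-diag g a =
  trans (projection-incidence g a a) (trans (cong (inv (degree g (g a)) *_) (incidence-≡ g refl)) (*-identityʳ _))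

constant⇒projection-uniform : ∀ {m n} (g : Fin m → Fin n) → (∀ c d → g c ≡ g d) →
  ∀ a c → normalizedProjection (incidence g) a c ≡ inv (count m)
constant⇒projection-uniform {m} g constant a c = begin
  normalizedProjection (incidence g) a c      ≡⟨ projection-incidence g a c ⟩
  inv (degree g (g a)) * incidence g c (g a)  ≡⟨ cong₂ _*_ (cong inv (constant⇒degree≡count g constant a))
                                                           (incidence-≡ g (constant c a)) ⟩
  inv (count m) * 1ℚ                          ≡⟨ *-identityʳ (inv (count m)) ⟩
  inv (count m)                               ∎

balanced-projections⇒same-fibres : ∀ {m n₁ n₂} (g : Fin m → Fin n₁) (h : Fin m → Fin n₂) a →
  let A = normalizedProjection (incidence g)
      B = normalizedProjection (incidence h) in
  (A · B) a a + (A · B) a a ≡ A a a + B a a →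
  ∀ c → incidence g c (g a) ≡ incidence h c (h a)
balanced-projections⇒same-fibres g h a balance c =
  x∙y⁻¹≈ε⇒x≈y _ _ (p*p≡0⇒p≡0 _ (sumᶠ-nonNeg-≡0 _ (λ c → 0≤p*p (x c - y c)) ∑[x-y]²≡0 c))
  where
  A B : Matrix _ _
  A = normalizedProjection (incidence g)
  B = normalizedProjection (incidence h)
  x y : Fin _ → ℚ
  x c = incidence g c (g a)
  y c = incidence h c (h a)
  F V k : ℚ
  F = degree g (g a)
  V = degree h (h a)
  k = sumᶠ (λ c → x c * y c)
  AB-diag : (A · B) a a ≡ inv F * inv V * k
  AB-diag = begin
    sumᶠ (λ c → A a c * B c a)                  ≡⟨ sumᶠ-cong (λ c → cong₂ _*_ (projection-incidence g a c)
                                                     (trans (normalizedProjection-sym (incidence h) c a)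
                                                            (projection-incidence h a c))) ⟩
    sumᶠ (λ c → (inv F * x c) * (inv V * y c))  ≡⟨ sumᶠ-cong (λ c → regroup (inv F) (inv V) (x c) (y c)) ⟩
    sumᶠ (λ c → inv F * inv V * (x c * y c))    ≡⟨ sumᶠ-*ˡ (inv F * inv V) (λ c → x c * y c) ⟩
    inv F * inv V * k                           ∎
    where
    regroup : ∀ p q s t → (p * s) * (q * t) ≡ p * q * (s * t)
    regroup = solve 4 (λ p q s t → (p :* s) :* (q :* t) := p :* q :* (s :* t)) refl
  2k≡F+V : k + k ≡ F + V
  2k≡F+V = cross-multiply {F} {V} {inv F} {inv V} k
             (inv-inverseˡ F (degree-≢0 g a)) (inv-inverseˡ V (degree-≢0 h a))
    (trans (sym (cong (λ s → s + s) AB-diag))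
           (trans balance (cong₂ _+_ (projection-incidence-diag g a) (projection-incidence-diag h a))))
  ∑[x-y]²≡0 : sumᶠ (λ c → (x c - y c) * (x c - y c)) ≡ 0ℚ
  ∑[x-y]²≡0 = trans (sumᶠ-square-of-difference x y) (x≈y⇒x∙y⁻¹≈ε (sym 2k≡F+V))

Reach-invariant : ∀ {n} {σ α : Fin n → Fin n} {B : Set} (t : Fin n → B) →
  (∀ x → t (σ x) ≡ t x) → (∀ x → t (α x) ≡ t x) → ∀ {a b} → Reach σ α a b → t b ≡ t a
Reach-invariant t tσ≡t tα≡t here      = refl
Reach-invariant t tσ≡t tα≡t (stepσ r) = trans (tσ≡t _) (Reach-invariant t tσ≡t tα≡t r)
Reach-invariant t tσ≡t tα≡t (stepα r) = trans (tα≡t _) (Reach-invariant t tσ≡t tα≡t r)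

surjective∧constant⇒codomain-irrelevant : ∀ {m n} (g : Fin m → Fin n) →
  (∀ w → ∃ λ a → g a ≡ w) → (∀ a b → g a ≡ g b) → ∀ (w v : Fin n) → w ≡ v
surjective∧constant⇒codomain-irrelevant g surjective constant w v with surjective w | surjective v
... | a , ga≡w | b , gb≡v = trans (sym ga≡w) (trans (constant a b) gb≡v)

inhabited∧irrelevant⇒≡1 : ∀ {n} → Fin n → (∀ (x y : Fin n) → x ≡ y) → n ≡ 1
inhabited∧irrelevant⇒≡1 {suc zero}    _ _          = refl
inhabited∧irrelevant⇒≡1 {suc (suc n)} _ irrelevant with irrelevant zero (suc zero)
... | ()

≡1⇒irrelevant : ∀ {n} → n ≡ 1 → ∀ (x y : Fin n) → x ≡ y
≡1⇒irrelevant refl zero zero = refl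

tail-σ : ∀ (X : OrientableMap) x → tail X (σ X ⟨$⟩ʳ x) ≡ tail X x
tail-σ X x = sym (proj₂ (tail-orbit X x (σ X ⟨$⟩ʳ x)) (1 , refl))

face-σα : ∀ (X : OrientableMap) x → face X (σ X ⟨$⟩ʳ α X x) ≡ face X x
face-σα X x = sym (proj₂ (face-orbit X x (σ X ⟨$⟩ʳ α X x)) (1 , refl))

U≡𝕀⇒same-face⇔same-tail : (X : OrientableMap) → (∀ a b → U X a b ≡ 𝕀 a b) →
  ∀ a c → (face X c ≡ face X a ⇔ tail X c ≡ tail X a)
U≡𝕀⇒same-face⇔same-tail X U≡𝕀 a c =
  mk⇔ (incidence-≡⇒ (face X) (tail X) same) (incidence-≡⇒ (tail X) (face X) (sym same))
  where
  same : incidence (face X) c (face X a) ≡ incidence (tail X) c (tail X a)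
  same = balanced-projections⇒same-fibres (face X) (tail X) a
           (Equivalence.to (twiceMinusI-·-≡𝕀 (P X) (Q X) a a) (U≡𝕀 a a)) c

same-face⇔same-tail⇒one-vertex-one-face : (X : OrientableMap) →
  (∀ a c → (face X c ≡ face X a ⇔ tail X c ≡ tail X a)) → nV X ≡ 1 × nF X ≡ 1
same-face⇔same-tail⇒one-vertex-one-face X same =
    inhabited∧irrelevant⇒≡1 (tail X a₀)
      (surjective∧constant⇒codomain-irrelevant (tail X) (tail-surj X) tail-constant)
  , inhabited∧irrelevant⇒≡1 (face X a₀)
      (surjective∧constant⇒codomain-irrelevant (face X) (face-surj X) face-constant)
  where
  a₀ : Fin (nA X)
  a₀ = Fin.fromℕ< (nonempty X)
  tail-α : ∀ x → tail X (α X x) ≡ tail X x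
  tail-α x = trans (sym (tail-σ X (α X x))) (Equivalence.to (same x (σ X ⟨$⟩ʳ α X x)) (face-σα X x))
  tail-constant : ∀ a b → tail X a ≡ tail X b
  tail-constant a b = sym (Reach-invariant (tail X) (tail-σ X) tail-α (connected X a b))
  face-constant : ∀ a b → face X a ≡ face X b
  face-constant a b = Equivalence.from (same b a) (tail-constant a b)

one-vertex-one-face⇒U≡𝕀 : (X : OrientableMap) → nV X ≡ 1 → nF X ≡ 1 → ∀ a b → U X a b ≡ 𝕀 a b
one-vertex-one-face⇒U≡𝕀 X nV≡1 nF≡1 a b =
  Equivalence.from (twiceMinusI-·-≡𝕀 (P X) (Q X) a b)
    (trans (cong₂ _+_ PQ≡uniform PQ≡uniform) (sym (cong₂ _+_ (P≡uniform a b) (Q≡uniform a b))))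
  where
  face-constant : ∀ c d → face X c ≡ face X d
  face-constant c d = ≡1⇒irrelevant nF≡1 (face X c) (face X d)
  tail-constant : ∀ c d → tail X c ≡ tail X d
  tail-constant c d = ≡1⇒irrelevant nV≡1 (tail X c) (tail X d)
  P≡uniform : ∀ c d → P X c d ≡ inv (count (nA X))
  P≡uniform = constant⇒projection-uniform (face X) face-constant
  Q≡uniform : ∀ c d → Q X c d ≡ inv (count (nA X))
  Q≡uniform = constant⇒projection-uniform (tail X) tail-constant
  count≢0 : count (nA X) ≢ 0ℚ
  count≢0 count≡0 = degree-≢0 (face X) a (trans (constant⇒degree≡count (face X) face-constant a) count≡0)
  PQ≡uniform : (P X · Q X) a b ≡ inv (count (nA X))
  PQ≡uniform = ·-uniform P≡uniform Q≡uniform (inv-inverseˡ (count (nA X)) count≢0) a b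

lemma6p1 : (X : OrientableMap) →
    (∀ a b → U X a b ≡ 𝕀 a b) ⇔ (nV X ≡ 1 × nF X ≡ 1)
lemma6p1 X = mk⇔
  (λ U≡𝕀 → same-face⇔same-tail⇒one-vertex-one-face X (U≡𝕀⇒same-face⇔same-tail X U≡𝕀))
  (λ (nV≡1 , nF≡1) → one-vertex-one-face⇒U≡𝕀 X nV≡1 nF≡1)
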